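{- There is no function $f:\mathbb{N}\times\mathbb{N}\to\mathbb{N}$ such that $\dim(\mathbf{P})\leq f(\dim(\mathbf{P}_1),\dim(\mathbf{P}_2))$ holds for every finite poset $\mathbf{P}$ which is induced by two sub-posets $\mathbf{P}_1$ and $\mathbf{P}_2$ with $\min(\mathbf{P}_1)=\max(\mathbf{P}_2)$.
   Context: The order dimension $\dim(\mathbf{Q})$ of a finite poset $\mathbf{Q}=(X,\preceq)$ is the least number $d$ of linear extensions $\preceq_1,\ldots,\preceq_d$ of $\preceq$ such that for all $x,y\in X$: $x\preceq y$ iff $x\preceq_i y$ for all $i\in[d]$. $\min(\mathbf{Q})$ and $\max(\mathbf{Q})$ denote the sets of minimal and maximal elements of $\mathbf{Q}$. "$\mathbf{P}$ is induced by two sub-posets $\mathbf{P}_1,\mathbf{P}_2$" means $\mathbf{P}$ is obtained by stacking $\mathbf{P}_1$ on top of $\mathbf{P}_2$: the ground set of $\mathbf{P}$ is the union of those of $\mathbf{P}_1$ and $\mathbf{P}_2$, they share exactly the elements $\min(\mathbf{P}_1)=\max(\mathbf{P}_2)$, and the order of $\mathbf{P}$ is the transitive closure of the relations of $\mathbf{P}_1$ and $\mathbf{P}_2$. -}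

module Defs where

open import Level using (0ℓ)
open import Data.Nat using (ℕ; _≤_)
open import Data.Fin using (Fin)
open import Data.Product using (Σ; ∃; _×_; _,_)
open import Data.Sum using (_⊎_)
open import Relation.Binary using (Rel; IsPartialOrder; IsTotalOrder)
open import Relation.Binary.PropositionalEquality using (_≡_)
open import Relation.Binary.Construct.Closure.Transitive using (TransClosure)

record FinPoset : Set₁ where
  field
    size  : ℕ
    _⊑_   : Rel (Fin size) 0ℓ
    isPO  : IsPartialOrder _≡_ _⊑_
open FinPoset public

record LinearExtension (P : FinPoset) : Set₁ where
  field
    _≼_     : Rel (Fin (size P)) 0ℓ
    isTotal : IsTotalOrder _≡_ _≼_
    extends : ∀ x y → _⊑_ P x y → x ≼ y
open LinearExtension public

-- A realizer of size d: d linear extensions whose intersection is ⊑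
-- (x ⊑ y iff x ≼ᵢ y for all i; the forward direction is `extends`).
record Realizer (P : FinPoset) (d : ℕ) : Set₁ where
  field
    ext       : Fin d → LinearExtension P
    realizes  : ∀ x y → (∀ i → _≼_ (ext i) x y) → _⊑_ P x y
open Realizer public

IsDim : FinPoset → ℕ → Set₁
IsDim P d = Realizer P d × (∀ d′ → Realizer P d′ → d ≤ d′)

IsMin : (Q : FinPoset) → Fin (size Q) → Set
IsMin Q a = ∀ a′ → _⊑_ Q a′ a → a′ ≡ a

IsMax : (Q : FinPoset) → Fin (size Q) → Set
IsMax Q b = ∀ b′ → _⊑_ Q b b′ → b′ ≡ b

ImgRel : ∀ {n} (Q : FinPoset) → (Fin (size Q) → Fin n) → Rel (Fin n) 0ℓ
ImgRel Q e x y = ∃ λ a → ∃ λ a′ → e a ≡ x × e a′ ≡ y × _⊑_ Q a a′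

record InducedBy (P P₁ P₂ : FinPoset) : Set₁ where
  field
    e₁      : Fin (size P₁) → Fin (size P)
    e₂      : Fin (size P₂) → Fin (size P)
    e₁-inj  : ∀ a a′ → e₁ a ≡ e₁ a′ → a ≡ a′
    e₂-inj  : ∀ b b′ → e₂ b ≡ e₂ b′ → b ≡ b′
    cover   : ∀ x → (∃ λ a → e₁ a ≡ x) ⊎ (∃ λ b → e₂ b ≡ x)
    shared  : ∀ a b → e₁ a ≡ e₂ b → IsMin P₁ a × IsMax P₂ b
    min⊆    : ∀ a → IsMin P₁ a → ∃ λ b → e₂ b ≡ e₁ a
    max⊆    : ∀ b → IsMax P₂ b → ∃ λ a → e₁ a ≡ e₂ b
    order→  : ∀ x y → _⊑_ P x y → TransClosure (λ u v → ImgRel P₁ e₁ u v ⊎ ImgRel P₂ e₂ u v) x y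
    order←  : ∀ x y → TransClosure (λ u v → ImgRel P₁ e₁ u v ⊎ ImgRel P₂ e₂ u v) x y → _⊑_ P x y

-- The poset P has three layers b_ik, m_ik, c_jk (i, j, k < n) with b_ik < m_ik′ and, for
-- i ≠ k, m_ik < c_jk; hence b_ik < c_jk′ exactly when i ≠ k′. Its lower half P₂ (the b's
-- and m's) and upper half P₁ (the m's and c's) are disjoint unions of weak orders and so
-- have dimension at most 2, while the elements b_ii and c_ii form the standard example S_n,
-- so dim P ≥ n. Choosing n larger than every f d₁ d₂ with d₁, d₂ ≤ 2 refutes f. Since
-- dimensions exist only classically, the argument runs under double negation, which is
-- harmless for a negated statement.
module Submission where

open import Defs
open import Data.Nat using (ℕ; _≤_)
open import Data.Product using (Σ)
open import Relation.Nullary using (¬_)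

open import Level using (0ℓ)
open import Data.Bool using (if_then_else_)
open import Data.Nat as ℕ using (zero; suc; _+_; _<_; _*_; _⊔_; z≤n; s≤s)
import Data.Nat.Properties as ℕ
open import Data.Nat.Induction using (<-rec)
open import Data.Fin as Fin using (Fin; toℕ; combine; remQuot)
import Data.Fin.Properties as Fin
open import Data.Fin.Patterns using (0F; 1F; 2F)
open import Data.Fin.Subset using (Subset; Side; inside; outside; _∈_; _⊂_; ∣_∣)
open import Data.Fin.Subset.Properties using (p⊂q⇒∣p∣<∣q∣)
open import Data.Vec using (tabulate)
open import Data.Vec.Properties using (lookup∘tabulate; []=⇒lookup; lookup⇒[]=)
open import Data.Product using (_×_; _,_; proj₁; proj₂; ∃; ∃₂)
open import Data.Product.Function.NonDependent.Propositional using (_×-↔_)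
open import Data.Product.Relation.Binary.Lex.Strict using (×-Lex; ×-isStrictTotalOrder)
open import Data.Sum as Sum using (_⊎_; inj₁; inj₂; [_,_]′)
open import Function using (_∘_; _on_; id; flip)
open import Function.Bundles using (_↔_; Inverse)
open import Function.Construct.Composition using (_↔-∘_)
open import Function.Construct.Identity using (↔-id)
open import Function.Definitions using (Injective)
open import Relation.Binary
  using (Rel; Decidable; Transitive; IsPartialOrder; IsTotalOrder; IsStrictTotalOrder; tri<; tri≈; tri>)
import Relation.Binary.Construct.Flip.EqAndOrd as Flip
open import Relation.Binary.Construct.Closure.Transitive using (TransClosure; [_]; _∷_)
open import Relation.Binary.PropositionalEquality
  using (_≡_; _≢_; refl; sym; trans; cong; subst; subst₂; isEquivalence)
open import Relation.Nullary using (Dec; yes; no; does; contradiction)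
open import Relation.Nullary.Decidable using (decidable-stable; ¬¬-excluded-middle; _⊎-dec_; _×-dec_)

-- Existence of the dimension

¬¬-finChoice : ∀ {b} n {B : Fin n → Set b} → (∀ i → ¬ ¬ B i) → ¬ ¬ (∀ i → B i)
¬¬-finChoice zero    _ k = k λ ()
¬¬-finChoice (suc n) h k =
  h 0F λ b₀ → ¬¬-finChoice n (h ∘ Fin.suc) λ b → k λ { 0F → b₀ ; (Fin.suc i) → b i }

¬¬-decidable : (P : FinPoset) → ¬ ¬ Decidable (_⊑_ P)
¬¬-decidable P = ¬¬-finChoice (size P) λ _ → ¬¬-finChoice (size P) λ _ → ¬¬-excluded-middle

¬¬-IsDim≤ : (P : FinPoset) → ∀ m → Realizer P m → ¬ ¬ (∃ λ d → IsDim P d × d ≤ m)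
¬¬-IsDim≤ P = <-rec _ λ m smaller R k → k (m , (R , minimal smaller k) , ℕ.≤-refl)
  where
  minimal : ∀ {m} → (∀ {d′} → d′ < m → Realizer P d′ → ¬ ¬ (∃ λ d → IsDim P d × d ≤ d′)) →
            ¬ (∃ λ d → IsDim P d × d ≤ m) → ∀ d′ → Realizer P d′ → m ≤ d′
  minimal {m} smaller k d′ R′ = decidable-stable (m ℕ.≤? d′) λ m≰d′ →
    let d′<m = ℕ.≰⇒> m≰d′ in
    smaller d′<m R′ λ (d , D , d≤d′) → k (d , D , ℕ.≤-trans d≤d′ (ℕ.<⇒≤ d′<m))

-- Linear extensions

module _ {B K : Set} {_<_ : Rel K 0ℓ} (<-irrefl : ∀ {k} → ¬ k < k) (<-trans : Transitive _<_) where

  ≡⊎-on-isPartialOrder : (f : B → K) → IsPartialOrder _≡_ (λ x y → x ≡ y ⊎ f x < f y)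
  ≡⊎-on-isPartialOrder f = record
    { isPreorder = record { isEquivalence = isEquivalence ; reflexive = inj₁ ; trans = ≤-trans }
    ; antisym    = ≤-antisym }
    where
    ≤-trans : ∀ {x y z} → x ≡ y ⊎ f x < f y → y ≡ z ⊎ f y < f z → x ≡ z ⊎ f x < f z
    ≤-trans (inj₁ refl) y≤z         = y≤z
    ≤-trans (inj₂ x<y)  (inj₁ refl) = inj₂ x<y
    ≤-trans (inj₂ x<y)  (inj₂ y<z)  = inj₂ (<-trans x<y y<z)
    ≤-antisym : ∀ {x y} → x ≡ y ⊎ f x < f y → y ≡ x ⊎ f y < f x → x ≡ y
    ≤-antisym (inj₁ x≡y) _          = x≡y
    ≤-antisym (inj₂ _)   (inj₁ y≡x) = sym y≡x
    ≤-antisym (inj₂ x<y) (inj₂ y<x) = contradiction (<-trans x<y y<x) <-irrefl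

module _ {K : Set} {_≈_ _<_ : Rel K 0ℓ} (<-sto : IsStrictTotalOrder _≈_ _<_) where
  open IsStrictTotalOrder <-sto using (compare; irrefl) renaming (trans to <-trans; module Eq to ≈)

  extensionByKey : (P : FinPoset) (key : Fin (size P) → K) →
                   (∀ {x y} → key x ≈ key y → x ≡ y) →
                   (∀ {x y} → _⊑_ P x y → x ≡ y ⊎ key x < key y) →
                   LinearExtension P
  extensionByKey P key key-injective key-monotone = record
    { _≼_     = λ x y → x ≡ y ⊎ key x < key y
    ; isTotal = record
      { isPartialOrder = ≡⊎-on-isPartialOrder (λ {k} → irrefl (≈.refl {k})) <-trans key
      ; total          = total }
    ; extends = λ _ _ → key-monotone }
    where
    total : ∀ x y → (x ≡ y ⊎ key x < key y) ⊎ (y ≡ x ⊎ key y < key x)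
    total x y with compare (key x) (key y)
    ... | tri< x<y _ _ = inj₁ (inj₂ x<y)
    ... | tri≈ _ x≈y _ = inj₁ (inj₁ (key-injective x≈y))
    ... | tri> _ _ y<x = inj₂ (inj₂ y<x)

module _ {n p} {Q : Fin n → Set p} (Q? : ∀ x → Dec (Q x)) where
  private
    side : Fin n → Side
    side x = if does (Q? x) then inside else outside

  subsetOf : Subset n
  subsetOf = tabulate side

  ∈-subsetOf⁺ : ∀ {x} → Q x → x ∈ subsetOf
  ∈-subsetOf⁺ {x} qx with Q? x | lookup∘tabulate side x
  ... | yes _  | lookup≡inside = lookup⇒[]= x _ lookup≡inside
  ... | no ¬qx | _             = contradiction qx ¬qx

  ∈-subsetOf⁻ : ∀ {x} → x ∈ subsetOf → Q x
  ∈-subsetOf⁻ {x} x∈ with Q? x | trans (sym (lookup∘tabulate side x)) ([]=⇒lookup x∈)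
  ... | yes qx | _ = qx
  ... | no _   | ()

module _ (P : FinPoset) (_⊑?_ : Decidable (_⊑_ P)) where
  private
    module ⊑ = IsPartialOrder (isPO P)

  downset : Fin (size P) → Subset (size P)
  downset x = subsetOf (_⊑? x)

  downset-⊂ : ∀ {x y} → _⊑_ P x y → x ≢ y → downset x ⊂ downset y
  downset-⊂ {x} {y} x⊑y x≢y =
    (λ u∈↓x → ∈-subsetOf⁺ (_⊑? y) (⊑.trans (∈-subsetOf⁻ (_⊑? x) u∈↓x) x⊑y)) ,
    y , ∈-subsetOf⁺ (_⊑? y) ⊑.refl , λ y∈↓x → x≢y (⊑.antisym x⊑y (∈-subsetOf⁻ (_⊑? x) y∈↓x))

  linearExtension : LinearExtension P
  linearExtension = extensionByKey (×-isStrictTotalOrder ℕ.<-isStrictTotalOrder ℕ.<-isStrictTotalOrder)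
    P (λ x → ∣ downset x ∣ , toℕ x) (Fin.toℕ-injective ∘ proj₂) monotone
    where
    monotone : ∀ {x y} → _⊑_ P x y →
               x ≡ y ⊎ ×-Lex _≡_ _<_ _<_ (∣ downset x ∣ , toℕ x) (∣ downset y ∣ , toℕ y)
    monotone {x} {y} x⊑y with x Fin.≟ y
    ... | yes x≡y = inj₁ x≡y
    ... | no x≢y  = inj₂ (inj₁ (p⊂q⇒∣p∣<∣q∣ (downset-⊂ x⊑y x≢y)))

module _ (P : FinPoset) {x y : Fin (size P)} (x⋢y : ¬ _⊑_ P x y) where
  private
    module ⊑ = IsPartialOrder (isPO P)

  placeBelow : FinPoset
  placeBelow = record
    { size = size P
    ; _⊑_  = _⊑′_
    ; isPO = record
      { isPreorder = record { isEquivalence = isEquivalence ; reflexive = inj₁ ∘ ⊑.reflexive ; trans = ⊑′-trans }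
      ; antisym    = ⊑′-antisym } }
    where
    _⊑′_ : Rel (Fin (size P)) 0ℓ
    u ⊑′ v = _⊑_ P u v ⊎ (_⊑_ P u y × _⊑_ P x v)
    ⊑′-trans : ∀ {u v w} → u ⊑′ v → v ⊑′ w → u ⊑′ w
    ⊑′-trans (inj₁ u⊑v)         (inj₁ v⊑w)         = inj₁ (⊑.trans u⊑v v⊑w)
    ⊑′-trans (inj₁ u⊑v)         (inj₂ (v⊑y , x⊑w)) = inj₂ (⊑.trans u⊑v v⊑y , x⊑w)
    ⊑′-trans (inj₂ (u⊑y , x⊑v)) (inj₁ v⊑w)         = inj₂ (u⊑y , ⊑.trans x⊑v v⊑w)
    ⊑′-trans (inj₂ (u⊑y , _))   (inj₂ (_ , x⊑w))   = inj₂ (u⊑y , x⊑w)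
    ⊑′-antisym : ∀ {u v} → u ⊑′ v → v ⊑′ u → u ≡ v
    ⊑′-antisym (inj₁ u⊑v)         (inj₁ v⊑u)         = ⊑.antisym u⊑v v⊑u
    ⊑′-antisym (inj₁ u⊑v)         (inj₂ (v⊑y , x⊑u)) = contradiction (⊑.trans x⊑u (⊑.trans u⊑v v⊑y)) x⋢y
    ⊑′-antisym (inj₂ (u⊑y , x⊑v)) (inj₁ v⊑u)         = contradiction (⊑.trans x⊑v (⊑.trans v⊑u u⊑y)) x⋢y
    ⊑′-antisym (inj₂ (_ , x⊑v))   (inj₂ (v⊑y , _))   = contradiction (⊑.trans x⊑v v⊑y) x⋢y

  module _ (_⊑?_ : Decidable (_⊑_ P)) where
    private
      L : LinearExtension placeBelow
      L = linearExtension placeBelow λ u v → u ⊑? v ⊎-dec (u ⊑? y ×-dec x ⊑? v)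

    reversingExtension : LinearExtension P
    reversingExtension = record { _≼_ = _≼_ L ; isTotal = isTotal L ; extends = λ u v → extends L u v ∘ inj₁ }

    reversingExtension-reverses : _≼_ reversingExtension y x
    reversingExtension-reverses = extends L y x (inj₂ (⊑.refl , ⊑.refl))

module _ (P : FinPoset) (_⊑?_ : Decidable (_⊑_ P)) where
  private
    module ⊑ = IsPartialOrder (isPO P)

  extensionFor : ∀ {x y} → Dec (_⊑_ P x y) → LinearExtension P
  extensionFor (yes _)   = linearExtension P _⊑?_
  extensionFor (no x⋢y) = reversingExtension P x⋢y _⊑?_

  extensionFor-reverses : ∀ {x y} → ¬ _⊑_ P x y → (x⊑?y : Dec (_⊑_ P x y)) → _≼_ (extensionFor x⊑?y) y x
  extensionFor-reverses x⋢y (yes x⊑y) = contradiction x⊑y x⋢y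
  extensionFor-reverses _   (no x⋢y)  = reversingExtension-reverses P x⋢y _⊑?_

  realizer : Realizer P (size P * size P)
  realizer = record { ext = extensionAt ; realizes = extensionAt-realizes }
    where
    extensionAt : Fin (size P * size P) → LinearExtension P
    extensionAt i = let (x , y) = remQuot (size P) i in extensionFor (x ⊑? y)
    extensionAt-realizes : ∀ x y → (∀ i → _≼_ (extensionAt i) x y) → _⊑_ P x y
    extensionAt-realizes x y x≼y = decidable-stable (x ⊑? y) λ x⋢y →
      let L    = extensionFor (x ⊑? y)
          x≼ᴸy = subst (λ (u , v) → _≼_ (extensionFor (u ⊑? v)) x y)
                       (Fin.remQuot-combine x y) (x≼y (combine x y))
      in x⋢y (⊑.reflexive (IsTotalOrder.antisym (isTotal L) x≼ᴸy (extensionFor-reverses x⋢y (x ⊑? y))))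

¬¬-IsDim : (P : FinPoset) → ¬ ¬ (∃ (IsDim P))
¬¬-IsDim P k = ¬¬-decidable P λ _⊑?_ →
  ¬¬-IsDim≤ P _ (realizer P _⊑?_) λ (d , D , _) → k (d , D)

-- The standard example

module _ (P : FinPoset) {n : ℕ} (a b : Fin n → Fin (size P))
         (a⊑b : ∀ {i k} → i ≢ k → _⊑_ P (a i) (b k)) (a⋢b : ∀ i → ¬ _⊑_ P (a i) (b i)) where
  private
    module ⊑ = IsPartialOrder (isPO P)

  -- Every pair (a i , b i) is reversed by some extension, and no extension reverses two of them.
  standardExample-≤ : ∀ {d} → Realizer P d → n ≤ d
  standardExample-≤ {d} R = decidable-stable (n ℕ.≤? d) λ n≰d →
    ¬¬-finChoice n reversedSomewhere λ reversal → n≰d (Fin.injective⇒≤ (reversal-injective reversal))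
    where
    Reverses : Fin n → Fin d → Set
    Reverses i j = _≼_ (ext R j) (b i) (a i)

    reversedSomewhere : ∀ i → ¬ ¬ ∃ (Reverses i)
    reversedSomewhere i none = a⋢b i (realizes R (a i) (b i) λ j →
      [ id , (λ b≼a → contradiction (j , b≼a) none) ]′ (IsTotalOrder.total (isTotal (ext R j)) (a i) (b i)))

    reversal-injective : (reversal : ∀ i → ∃ (Reverses i)) → Injective _≡_ _≡_ (proj₁ ∘ reversal)
    reversal-injective reversal {i} {k} same with i Fin.≟ k
    ... | yes i≡k = i≡k
    ... | no i≢k  = contradiction (⊑.reflexive (antisym aᵢ≼bᵢ (proj₂ (reversal i)))) (a⋢b i)
      where
      L = ext R (proj₁ (reversal i))
      open IsTotalOrder (isTotal L) using (antisym) renaming (trans to ≼-trans)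
      bₖ≼aₖ : _≼_ L (b k) (a k)
      bₖ≼aₖ = subst (λ j → _≼_ (ext R j) (b k) (a k)) (sym same) (proj₂ (reversal k))
      aᵢ≼bᵢ : _≼_ L (a i) (b i)
      aᵢ≼bᵢ = ≼-trans (extends L _ _ (a⊑b i≢k)) (≼-trans bₖ≼aₖ (extends L _ _ (a⊑b (i≢k ∘ sym))))

-- Disjoint unions of weak orders

record WeakOrderSum (P : FinPoset) : Set where
  field
    block level : Fin (size P) → ℕ
    ⊑⇒ : ∀ {x y} → _⊑_ P x y → x ≡ y ⊎ (block x ≡ block y × level x < level y)
    ⇒⊑ : ∀ {x y} → block x ≡ block y → level x < level y → _⊑_ P x y

module _ {P : FinPoset} (W : WeakOrderSum P) where
  open WeakOrderSum W
  private
    module ⊑ = IsPartialOrder (isPO P)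

    key : Fin (size P) → ℕ × ℕ × ℕ
    key x = block x , level x , toℕ x

    lexExtension : {_<₁_ _<₃_ : Rel ℕ 0ℓ} →
                   IsStrictTotalOrder _≡_ _<₁_ → IsStrictTotalOrder _≡_ _<₃_ → LinearExtension P
    lexExtension sto₁ sto₃ =
      extensionByKey (×-isStrictTotalOrder sto₁ (×-isStrictTotalOrder ℕ.<-isStrictTotalOrder sto₃))
        P key (Fin.toℕ-injective ∘ proj₂ ∘ proj₂) (Sum.map₂ (λ (β≡ , λ<) → inj₂ (β≡ , inj₁ λ<)) ∘ ⊑⇒)

    ascending descending : LinearExtension P
    ascending  = lexExtension ℕ.<-isStrictTotalOrder ℕ.<-isStrictTotalOrder
    descending = lexExtension (Flip.isStrictTotalOrder ℕ.<-isStrictTotalOrder)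
                              (Flip.isStrictTotalOrder ℕ.<-isStrictTotalOrder)

    _<ᵃ_ _<ᵈ_ : Rel (ℕ × ℕ × ℕ) 0ℓ
    _<ᵃ_ = ×-Lex _≡_ _<_ (×-Lex _≡_ _<_ _<_)
    _<ᵈ_ = ×-Lex _≡_ (flip _<_) (×-Lex _≡_ _<_ (flip _<_))

    sameBlock-lowerLevel : ∀ {x y} → key x <ᵃ key y → key x <ᵈ key y →
                           block x ≡ block y × level x < level y
    sameBlock-lowerLevel (inj₁ β<β′)                 (inj₁ β′<β)                  = contradiction β′<β (ℕ.<-asym β<β′)
    sameBlock-lowerLevel (inj₁ β<β′)                 (inj₂ (β≡β′ , _))            = contradiction β<β′ (ℕ.<-irrefl β≡β′)
    sameBlock-lowerLevel (inj₂ (β≡β′ , inj₁ λ<λ′))  _                            = β≡β′ , λ<λ′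
    sameBlock-lowerLevel (inj₂ (β≡β′ , inj₂ _))     (inj₁ β′<β)                  = contradiction β′<β (ℕ.<-irrefl (sym β≡β′))
    sameBlock-lowerLevel (inj₂ (β≡β′ , inj₂ _))     (inj₂ (_ , inj₁ λ<λ′))       = β≡β′ , λ<λ′
    sameBlock-lowerLevel (inj₂ (_ , inj₂ (_ , ι<ι′))) (inj₂ (_ , inj₂ (_ , ι′<ι))) = contradiction ι′<ι (ℕ.<-asym ι<ι′)

  weakOrderSum-realizer : Realizer P 2
  weakOrderSum-realizer = record { ext = extensions ; realizes = extensions-realize }
    where
    extensions : Fin 2 → LinearExtension P
    extensions 0F = ascending
    extensions 1F = descending
    extensions-realize : ∀ x y → (∀ i → _≼_ (extensions i) x y) → _⊑_ P x y
    extensions-realize x y x≼y with x≼y 0F | x≼y 1F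
    ... | inj₁ x≡y  | _         = ⊑.reflexive x≡y
    ... | inj₂ _    | inj₁ x≡y  = ⊑.reflexive x≡y
    ... | inj₂ x<ᵃy | inj₂ x<ᵈy = let (β≡ , λ<) = sameBlock-lowerLevel x<ᵃy x<ᵈy in ⇒⊑ β≡ λ<

module Enumerated {A : Set} {s : ℕ} (enum : Fin s ↔ A) (_≺_ : Rel A 0ℓ)
                  (≺-irrefl : ∀ {p} → ¬ p ≺ p) (≺-trans : Transitive _≺_) where
  open Inverse enum public using (to; from; strictlyInverseˡ; strictlyInverseʳ)

  poset : FinPoset
  poset = record
    { size = s
    ; _⊑_  = λ x y → x ≡ y ⊎ to x ≺ to y
    ; isPO = ≡⊎-on-isPartialOrder (λ {p} → ≺-irrefl {p}) ≺-trans to }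

  from-injective : Injective _≡_ _≡_ from
  from-injective {p} {q} eq = trans (sym (strictlyInverseˡ p)) (trans (cong to eq) (strictlyInverseˡ q))

  to-injective : Injective _≡_ _≡_ to
  to-injective {x} {y} eq = trans (sym (strictlyInverseʳ x)) (trans (cong from eq) (strictlyInverseʳ y))

  from-mono : ∀ {p q} → p ≺ q → _⊑_ poset (from p) (from q)
  from-mono {p} {q} p≺q = inj₂ (subst₂ _≺_ (sym (strictlyInverseˡ p)) (sym (strictlyInverseˡ q)) p≺q)

  from-⊑⇒ : ∀ {p q} → _⊑_ poset (from p) (from q) → p ≡ q ⊎ p ≺ q
  from-⊑⇒         (inj₁ from≡) = inj₁ (from-injective from≡)
  from-⊑⇒ {p} {q} (inj₂ p≺q)   = inj₂ (subst₂ _≺_ (strictlyInverseˡ p) (strictlyInverseˡ q) p≺q)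

  weakOrderSum : (block level : A → ℕ) →
                 (∀ {p q} → p ≺ q → block p ≡ block q × level p < level q) →
                 (∀ {p q} → block p ≡ block q → level p < level q → p ≺ q) →
                 WeakOrderSum poset
  weakOrderSum block level ≺⇒ ⇒≺ = record
    { block = block ∘ to
    ; level = level ∘ to
    ; ⊑⇒    = Sum.map₂ ≺⇒
    ; ⇒⊑    = λ β≡ λ< → inj₂ (⇒≺ β≡ λ<) }

module Stacking {A A₁ A₂ : Set} {s s₁ s₂ : ℕ}
                (enum : Fin s ↔ A) (enum₁ : Fin s₁ ↔ A₁) (enum₂ : Fin s₂ ↔ A₂)
                (_≺_ : Rel A 0ℓ) (≺-irrefl : ∀ {p} → ¬ p ≺ p) (≺-trans : Transitive _≺_)
                {ι₁ : A₁ → A} {ι₂ : A₂ → A} where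

  module E  = Enumerated enum _≺_ ≺-irrefl ≺-trans
  module E₁ = Enumerated enum₁ (_≺_ on ι₁) ≺-irrefl ≺-trans
  module E₂ = Enumerated enum₂ (_≺_ on ι₂) ≺-irrefl ≺-trans

  InImage : ∀ {B : Set} → (B → A) → Rel A 0ℓ
  InImage ι u v = ∃₂ λ a a′ → ι a ≡ u × ι a′ ≡ v

  Step : Rel A 0ℓ
  Step u v = u ≺ v × (InImage ι₁ u v ⊎ InImage ι₂ u v)

  Minimal₁ : A₁ → Set
  Minimal₁ a = ∀ a′ → ¬ ι₁ a′ ≺ ι₁ a

  Maximal₂ : A₂ → Set
  Maximal₂ b = ∀ b′ → ¬ ι₂ b ≺ ι₂ b′

  private
    module Embedding {B : Set} {t : ℕ} (enumB : Fin t ↔ B) (ι : B → A) where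
      module EB = Enumerated enumB (_≺_ on ι) ≺-irrefl ≺-trans

      e : Fin t → Fin s
      e = E.from ∘ ι ∘ EB.to

      e-injective : Injective _≡_ _≡_ ι → Injective _≡_ _≡_ e
      e-injective ι-injective = EB.to-injective ∘ ι-injective ∘ E.from-injective

      e∘from : ∀ b → e (EB.from b) ≡ E.from (ι b)
      e∘from b = cong (E.from ∘ ι) (EB.strictlyInverseˡ b)

      preimage : ∀ {x} → (∃ λ b → ι b ≡ E.to x) → ∃ λ c → e c ≡ x
      preimage {x} (b , ιb≡x) = EB.from b , trans (e∘from b) (trans (cong E.from ιb≡x) (E.strictlyInverseʳ x))

      image-refl : ∀ {x} → (∃ λ b → ι b ≡ E.to x) → ImgRel EB.poset e x x
      image-refl ιb≡x = let (c , ec≡x) = preimage ιb≡x in c , c , ec≡x , ec≡x , inj₁ refl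

      image-step : ∀ {u v} → u ≺ v → InImage ι u v → ImgRel EB.poset e (E.from u) (E.from v)
      image-step u≺v (b , b′ , refl , refl) =
        EB.from b , EB.from b′ , e∘from b , e∘from b′ , EB.from-mono u≺v

      image-⊑ : ∀ {x y} → ImgRel EB.poset e x y → _⊑_ E.poset x y
      image-⊑ (_ , _ , refl , refl , inj₁ refl) = inj₁ refl
      image-⊑ (_ , _ , refl , refl , inj₂ ι≺ι′) = E.from-mono ι≺ι′

      isMin⁺ : ∀ {c} → (∀ b′ → ¬ ι b′ ≺ ι (EB.to c)) → IsMin EB.poset c
      isMin⁺ _      _ (inj₁ c′≡c) = c′≡c
      isMin⁺ {c} nothing-below c′ (inj₂ ι≺ι) = contradiction ι≺ι (nothing-below (EB.to c′))

      isMin⁻ : ∀ {c} → IsMin EB.poset c → ∀ b′ → ¬ ι b′ ≺ ι (EB.to c)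
      isMin⁻ {c} min b′ ι≺ι
        with min (EB.from b′) (inj₂ (subst (λ b → ι b ≺ ι (EB.to c)) (sym (EB.strictlyInverseˡ b′)) ι≺ι))
      ... | refl = ≺-irrefl (subst (λ b → ι b′ ≺ ι b) (EB.strictlyInverseˡ b′) ι≺ι)

      isMax⁺ : ∀ {c} → (∀ b′ → ¬ ι (EB.to c) ≺ ι b′) → IsMax EB.poset c
      isMax⁺ _      _ (inj₁ c≡c′) = sym c≡c′
      isMax⁺ {c} nothing-above c′ (inj₂ ι≺ι) = contradiction ι≺ι (nothing-above (EB.to c′))

      isMax⁻ : ∀ {c} → IsMax EB.poset c → ∀ b′ → ¬ ι (EB.to c) ≺ ι b′
      isMax⁻ {c} max b′ ι≺ι
        with max (EB.from b′) (inj₂ (subst (λ b → ι (EB.to c) ≺ ι b) (sym (EB.strictlyInverseˡ b′)) ι≺ι))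
      ... | refl = ≺-irrefl (subst (λ b → ι b ≺ ι b′) (EB.strictlyInverseˡ b′) ι≺ι)

    module Emb₁ = Embedding enum₁ ι₁
    module Emb₂ = Embedding enum₂ ι₂

    _∼_ : Rel (Fin s) 0ℓ
    x ∼ y = ImgRel E₁.poset Emb₁.e x y ⊎ ImgRel E₂.poset Emb₂.e x y

  inducedBy : Injective _≡_ _≡_ ι₁ → Injective _≡_ _≡_ ι₂ →
              (∀ p → (∃ λ a → ι₁ a ≡ p) ⊎ (∃ λ b → ι₂ b ≡ p)) →
              (∀ {a b} → ι₁ a ≡ ι₂ b → Minimal₁ a × Maximal₂ b) →
              (∀ a → Minimal₁ a → ∃ λ b → ι₂ b ≡ ι₁ a) →
              (∀ b → Maximal₂ b → ∃ λ a → ι₁ a ≡ ι₂ b) →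
              (∀ {p q} → p ≺ q → TransClosure Step p q) →
              InducedBy E.poset E₁.poset E₂.poset
  inducedBy ι₁-injective ι₂-injective cover shared min⊆ max⊆ factor = record
    { e₁      = Emb₁.e
    ; e₂      = Emb₂.e
    ; e₁-inj  = λ _ _ → Emb₁.e-injective ι₁-injective
    ; e₂-inj  = λ _ _ → Emb₂.e-injective ι₂-injective
    ; cover   = λ x → Sum.map Emb₁.preimage Emb₂.preimage (cover (E.to x))
    ; shared  = λ a b e₁a≡e₂b → let (min , max) = shared (E.from-injective e₁a≡e₂b) in
                                Emb₁.isMin⁺ min , Emb₂.isMax⁺ max
    ; min⊆    = λ a min → let (b , ι₂b≡) = min⊆ (E₁.to a) (Emb₁.isMin⁻ min) in
                          E₂.from b , trans (Emb₂.e∘from b) (cong E.from ι₂b≡)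
    ; max⊆    = λ b max → let (a , ι₁a≡) = max⊆ (E₂.to b) (Emb₂.isMax⁻ max) in
                          E₁.from a , trans (Emb₁.e∘from a) (cong E.from ι₁a≡)
    ; order→  = order→
    ; order←  = λ _ _ → chain⇒⊑ }
    where
    module ⊑ = IsPartialOrder (isPO E.poset)

    image-step : ∀ {u v} → Step u v → E.from u ∼ E.from v
    image-step (u≺v , inj₁ im) = inj₁ (Emb₁.image-step u≺v im)
    image-step (u≺v , inj₂ im) = inj₂ (Emb₂.image-step u≺v im)

    image-chain : ∀ {u v} → TransClosure Step u v → TransClosure _∼_ (E.from u) (E.from v)
    image-chain [ st ]     = [ image-step st ]
    image-chain (st ∷ sts) = image-step st ∷ image-chain sts

    order→ : ∀ x y → _⊑_ E.poset x y → TransClosure _∼_ x y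
    order→ x _ (inj₁ refl) = [ Sum.map Emb₁.image-refl Emb₂.image-refl (cover (E.to x)) ]
    order→ x y (inj₂ x≺y)  =
      subst₂ (TransClosure _∼_) (E.strictlyInverseʳ x) (E.strictlyInverseʳ y) (image-chain (factor x≺y))

    chain⇒⊑ : ∀ {x y} → TransClosure _∼_ x y → _⊑_ E.poset x y
    chain⇒⊑ [ r ]     = [ Emb₁.image-⊑ , Emb₂.image-⊑ ]′ r
    chain⇒⊑ (r ∷ rs) = ⊑.trans ([ Emb₁.image-⊑ , Emb₂.image-⊑ ]′ r) (chain⇒⊑ rs)

-- The counterexample

supTo : (ℕ → ℕ) → ℕ → ℕ
supTo g zero    = g zero
supTo g (suc k) = supTo g k ⊔ g (suc k)

≤-supTo : ∀ g {i k} → i ≤ k → g i ≤ supTo g k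
≤-supTo g {k = zero}  z≤n = ℕ.≤-refl
≤-supTo g {k = suc k} i≤1+k with ℕ.m≤n⇒m<n∨m≡n i≤1+k
... | inj₁ i<1+k = ℕ.≤-trans (≤-supTo g (ℕ.s≤s⁻¹ i<1+k)) (ℕ.m≤m⊔n (supTo g k) (g (suc k)))
... | inj₂ refl  = ℕ.m≤n⊔m (supTo g k) (g (suc k))

Layers : ℕ → ℕ → Set
Layers l n = Fin l × Fin n × Fin n

enumLayers : ∀ l n → Fin (l * (n * n)) ↔ Layers l n
enumLayers l n = (↔-id _ ×-↔ Fin.*↔×) ↔-∘ Fin.*↔×

module Construction (m : ℕ) where
  n : ℕ
  n = 2 + m

  pattern bot i k = (0F , i , k)
  pattern mid i k = (1F , i , k)
  pattern top j k = (2F , j , k)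

  data _⋖_ : Rel (Layers 3 n) 0ℓ where
    bot⋖mid : ∀ {i k k′}   → bot i k ⋖ mid i k′
    mid⋖top : ∀ {i j k}    → i ≢ k  → mid i k ⋖ top j k
    bot⋖top : ∀ {i j k k′} → i ≢ k′ → bot i k ⋖ top j k′

  ⋖-irrefl : ∀ {p} → ¬ p ⋖ p
  ⋖-irrefl ()

  ⋖-trans : Transitive _⋖_
  ⋖-trans bot⋖mid     (mid⋖top i≢k) = bot⋖top i≢k
  ⋖-trans (mid⋖top _) ()
  ⋖-trans (bot⋖top _) ()

  ι₁ ι₂ : Layers 2 n → Layers 3 n
  ι₁ (l , x) = Fin.suc l , x
  ι₂ (l , x) = Fin.inject₁ l , x

  open Stacking (enumLayers 3 n) (enumLayers 2 n) (enumLayers 2 n) _⋖_ ⋖-irrefl ⋖-trans {ι₁} {ι₂}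

  P P₁ P₂ : FinPoset
  P  = E.poset
  P₁ = E₁.poset
  P₂ = E₂.poset

  ι₁-injective : Injective _≡_ _≡_ ι₁
  ι₁-injective {0F , _} {0F , _} refl = refl
  ι₁-injective {1F , _} {1F , _} refl = refl

  ι₂-injective : Injective _≡_ _≡_ ι₂
  ι₂-injective {0F , _} {0F , _} refl = refl
  ι₂-injective {1F , _} {1F , _} refl = refl

  cover : ∀ p → (∃ λ a → ι₁ a ≡ p) ⊎ (∃ λ b → ι₂ b ≡ p)
  cover (bot i k) = inj₂ ((0F , i , k) , refl)
  cover (mid i k) = inj₂ ((1F , i , k) , refl)
  cover (top j k) = inj₁ ((1F , j , k) , refl)

  shared : ∀ {a b} → ι₁ a ≡ ι₂ b → Minimal₁ a × Maximal₂ b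
  shared {0F , _} {1F , _} refl = (λ { (0F , _) () ; (1F , _) () }) , (λ { (0F , _) () ; (1F , _) () })

  other : Fin n → Fin n
  other 0F          = 1F
  other (Fin.suc _) = 0F

  other-≢ : ∀ k → other k ≢ k
  other-≢ 0F          ()
  other-≢ (Fin.suc _) ()

  minimal₁⇒shared : ∀ a → Minimal₁ a → ∃ λ b → ι₂ b ≡ ι₁ a
  minimal₁⇒shared (0F , i , k) _   = (1F , i , k) , refl
  minimal₁⇒shared (1F , j , k) min = contradiction (mid⋖top (other-≢ k)) (min (0F , other k , k))

  maximal₂⇒shared : ∀ b → Maximal₂ b → ∃ λ a → ι₁ a ≡ ι₂ b
  maximal₂⇒shared (1F , i , k) _   = (0F , i , k) , refl
  maximal₂⇒shared (0F , i , k) max = contradiction bot⋖mid (max (1F , i , k))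

  factor : ∀ {p q} → p ⋖ q → TransClosure Step p q
  factor (bot⋖mid {i} {k} {k′}) = [ bot⋖mid , inj₂ ((0F , i , k) , (1F , i , k′) , refl , refl) ]
  factor (mid⋖top {i} {j} {k} i≢k) = [ mid⋖top i≢k , inj₁ ((0F , i , k) , (1F , j , k) , refl , refl) ]
  factor (bot⋖top {i} {j} {k} {k′} i≢k′) =
    (bot⋖mid , inj₂ ((0F , i , k) , (1F , i , k′) , refl , refl)) ∷
    [ mid⋖top i≢k′ , inj₁ ((0F , i , k′) , (1F , j , k′) , refl , refl) ]

  P-inducedBy : InducedBy P P₁ P₂
  P-inducedBy = inducedBy ι₁-injective ι₂-injective cover shared minimal₁⇒shared maximal₂⇒shared factor

  level : Layers 2 n → ℕ
  level (l , _) = toℕ l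

  block₂ : Layers 2 n → ℕ
  block₂ (_ , i , _) = toℕ i

  P₂-weakOrderSum : WeakOrderSum P₂
  P₂-weakOrderSum = E₂.weakOrderSum block₂ level ⋖⇒ ⇒⋖
    where
    ⋖⇒ : ∀ {p q} → ι₂ p ⋖ ι₂ q → block₂ p ≡ block₂ q × level p < level q
    ⋖⇒ {0F , _} {1F , _} bot⋖mid = refl , ℕ.z<s
    ⇒⋖ : ∀ {p q} → block₂ p ≡ block₂ q → level p < level q → ι₂ p ⋖ ι₂ q
    ⇒⋖ {0F , i , _} {1F , j , _} i≡j _ with Fin.toℕ-injective i≡j
    ... | refl = bot⋖mid
    ⇒⋖ {1F , _} {1F , _} _ (s≤s ())

  -- mid k k lies below nothing, so it gets a block n + k of its own.
  block₁ : Layers 2 n → ℕ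
  block₁ (0F , i , k) with i Fin.≟ k
  ... | yes _ = n + toℕ i
  ... | no _  = toℕ k
  block₁ (1F , _ , k) = toℕ k

  P₁-weakOrderSum : WeakOrderSum P₁
  P₁-weakOrderSum = E₁.weakOrderSum block₁ level ⋖⇒ ⇒⋖
    where
    ⋖⇒ : ∀ {p q} → ι₁ p ⋖ ι₁ q → block₁ p ≡ block₁ q × level p < level q
    ⋖⇒ {0F , i , k} {1F , _ , _} (mid⋖top i≢k) with i Fin.≟ k
    ... | yes i≡k = contradiction i≡k i≢k
    ... | no _    = refl , ℕ.z<s
    ⇒⋖ : ∀ {p q} → block₁ p ≡ block₁ q → level p < level q → ι₁ p ⋖ ι₁ q
    ⇒⋖ {0F , i , k} {1F , _ , k′} β≡ _ with i Fin.≟ k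
    ... | yes _   = contradiction (sym β≡) (ℕ.<⇒≢ (ℕ.<-≤-trans (Fin.toℕ<n k′) (ℕ.m≤m+n n (toℕ i))))
    ... | no i≢k with Fin.toℕ-injective β≡
    ...   | refl = mid⋖top i≢k
    ⇒⋖ {1F , _} {1F , _} _ (s≤s ())

  realizer⇒n≤ : ∀ {d} → Realizer P d → n ≤ d
  realizer⇒n≤ = standardExample-≤ P (λ i → E.from (bot i i)) (λ i → E.from (top i i))
    (λ {i} {k} i≢k → E.from-mono (bot⋖top {i} {k} {i} {k} i≢k)) bot⋢top
    where
    bot⋢top : ∀ i → ¬ _⊑_ P (E.from (bot i i)) (E.from (top i i))
    bot⋢top i bot⊑top with E.from-⊑⇒ {bot i i} {top i i} bot⊑top
    ... | inj₂ (bot⋖top i≢i) = i≢i refl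

mainTheorem6 : ¬ (Σ (ℕ → ℕ → ℕ) λ f →
                  ∀ (P P₁ P₂ : FinPoset) → InducedBy P P₁ P₂ →
                  ∀ d d₁ d₂ → IsDim P d → IsDim P₁ d₁ → IsDim P₂ d₂ →
                  d ≤ f d₁ d₂)
mainTheorem6 (f , bounded) =
  ¬¬-IsDim≤ P₁ 2 (weakOrderSum-realizer P₁-weakOrderSum) λ (d₁ , dim₁ , d₁≤2) →
  ¬¬-IsDim≤ P₂ 2 (weakOrderSum-realizer P₂-weakOrderSum) λ (d₂ , dim₂ , d₂≤2) →
  ¬¬-IsDim P λ (d , dim) →
  ℕ.m+n≮n 1 B (begin-strict
    1 + B          <⟨ realizer⇒n≤ (proj₁ dim) ⟩
    d              ≤⟨ bounded P P₁ P₂ P-inducedBy d d₁ d₂ dim dim₁ dim₂ ⟩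
    f d₁ d₂        ≤⟨ ≤-supTo (f d₁) d₂≤2 ⟩
    supTo (f d₁) 2 ≤⟨ ≤-supTo (λ i → supTo (f i) 2) d₁≤2 ⟩
    B              ∎)
  where
  B : ℕ
  B = supTo (λ i → supTo (f i) 2) 2
  open Construction B
  open ℕ.≤-Reasoning
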